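{- Let $n$ be a congruent number. Then there exist a nonzero rational $q$ and a right triangle with rational side lengths and area $q^2 n$ whose $a$-, $b$-, or $c$-excircle has radius $1$.
   Context: A congruent number is a positive integer (or positive rational) that is the area of a right triangle with rational side lengths. For a right triangle with legs $a=BC$, $b=CA$ and hypotenuse $c=AB$, the $a$-, $b$-, $c$-excircles are the circles tangent to the sides $BC$, $CA$, $AB$ respectively and to the extensions of the other two sides. -}

module Defs where

open import Data.Nat using (ℕ)
open import Data.Integer using (+_)
open import Data.Rational using (ℚ; 0ℚ; 1ℚ; _+_; _*_; _-_; _<_; ½; _/_)
open import Data.Product using (Σ; _×_; ∃)
open import Relation.Binary.PropositionalEquality using (_≡_)

-- A right triangle with rational sides: legs a = BC, b = CA, hypotenuse c = AB.
record RatRightTriangle : Set where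
  constructor mkTri
  field
    a b c : ℚ
    a-pos : 0ℚ < a
    b-pos : 0ℚ < b
    c-pos : 0ℚ < c
    pythag : a * a + b * b ≡ c * c

open RatRightTriangle public

area : RatRightTriangle → ℚ
area t = ½ * (a t * b t)

semiperimeter : RatRightTriangle → ℚ
semiperimeter t = ½ * (a t + b t + c t)

Congruent : ℕ → Set
Congruent n = Σ RatRightTriangle λ t → area t ≡ (+ n) / 1

-- The excircle tangent to a side of length x has radius r_x = area / (s - x),
-- where s is the semiperimeter (s - x > 0 for any triangle).  We state
-- "r_x = r" division-free as  r * (s - x) = area.
ExradiusIs : RatRightTriangle → ℚ → ℚ → Set
ExradiusIs t x r = r * (semiperimeter t - x) ≡ area t

a-exradiusIs b-exradiusIs c-exradiusIs : RatRightTriangle → ℚ → Set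
a-exradiusIs t r = ExradiusIs t (a t) r
b-exradiusIs t r = ExradiusIs t (b t) r
c-exradiusIs t r = ExradiusIs t (c t) r

{-# OPTIONS --safe #-}
-- In a right triangle the c-exradius equals the semiperimeter s: since a² + b² = c²,
-- s (s − c) = ((a + b)² − c²) / 4 = ab / 2 is the area.  Scaling a triangle by k > 0
-- multiplies every exradius by k and the area by the square k², so scaling a triangle
-- of area n by 1/s gives one of area n/s² with c-exradius 1.
module Submission where

open import Defs
open import Data.Nat using (ℕ)
open import Data.Integer using (+_)
open import Data.Rational using (ℚ; 0ℚ; 1ℚ; _+_; _*_; _-_; _/_; ½; 1/_; _<_; Positive; positive; NonZero)
open import Data.Rational.Properties
  using (positive⁻¹; pos⇒nonZero; pos+pos⇒pos; pos*pos⇒pos; 1/pos⇒pos; *-inverseˡ; <⇒≢)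
open import Data.Product using (Σ; _×_; _,_)
open import Data.Sum using (_⊎_; inj₂)
open import Data.Rational.Solver using (module +-*-Solver)
open import Relation.Binary.PropositionalEquality using (_≡_; _≢_; refl; sym; trans; cong; subst; ≢-sym)
open Relation.Binary.PropositionalEquality.≡-Reasoning
open +-*-Solver using (solve; _:+_; _:*_; _:-_; _:=_; con)

semiperimeter-pos : ∀ t → Positive (semiperimeter t)
semiperimeter-pos t = pos*pos⇒pos ½ (a t + b t + c t) {{pos+pos⇒pos (a t + b t) (c t)}}
  where
  instance
    a-positive : Positive (a t)
    a-positive = positive (a-pos t)
    b-positive : Positive (b t)
    b-positive = positive (b-pos t)
    c-positive : Positive (c t)
    c-positive = positive (c-pos t)
    a+b-positive : Positive (a t + b t)
    a+b-positive = pos+pos⇒pos (a t) (b t)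

c-exradiusIs-semiperimeter : ∀ t → c-exradiusIs t (semiperimeter t)
c-exradiusIs-semiperimeter (mkTri a b c _ _ _ a²+b²≡c²) = begin
  ½ * (a + b + c) * (½ * (a + b + c) - c)        ≡⟨ expand a b c ⟩
  ½ * (a * b) + ½ * ½ * ((a * a + b * b) - c * c) ≡⟨ cong (λ z → ½ * (a * b) + ½ * ½ * (z - c * c)) a²+b²≡c² ⟩
  ½ * (a * b) + ½ * ½ * (c * c - c * c)           ≡⟨ cancel a b c ⟩
  ½ * (a * b)                                     ∎
  where
  expand : ∀ a b c → ½ * (a + b + c) * (½ * (a + b + c) - c) ≡ ½ * (a * b) + ½ * ½ * ((a * a + b * b) - c * c)
  expand = solve 3 (λ a b c → con ½ :* (a :+ b :+ c) :* (con ½ :* (a :+ b :+ c) :- c)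
                        := con ½ :* (a :* b) :+ con ½ :* con ½ :* ((a :* a :+ b :* b) :- c :* c)) refl
  cancel : ∀ a b c → ½ * (a * b) + ½ * ½ * (c * c - c * c) ≡ ½ * (a * b)
  cancel = solve 3 (λ a b c → con ½ :* (a :* b) :+ con ½ :* con ½ :* (c :* c :- c :* c) := con ½ :* (a :* b)) refl

pythagoras-scale : ∀ k {a b c} → a * a + b * b ≡ c * c → (k * a) * (k * a) + (k * b) * (k * b) ≡ (k * c) * (k * c)
pythagoras-scale k {a} {b} {c} a²+b²≡c² = begin
  (k * a) * (k * a) + (k * b) * (k * b) ≡⟨ factor k a b ⟩
  (k * k) * (a * a + b * b)             ≡⟨ cong ((k * k) *_) a²+b²≡c² ⟩
  (k * k) * (c * c)                     ≡⟨ unfactor k c ⟩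
  (k * c) * (k * c)                     ∎
  where
  factor : ∀ k a b → (k * a) * (k * a) + (k * b) * (k * b) ≡ (k * k) * (a * a + b * b)
  factor = solve 3 (λ k a b → (k :* a) :* (k :* a) :+ (k :* b) :* (k :* b) := (k :* k) :* (a :* a :+ b :* b)) refl
  unfactor : ∀ k c → (k * k) * (c * c) ≡ (k * c) * (k * c)
  unfactor = solve 2 (λ k c → (k :* k) :* (c :* c) := (k :* c) :* (k :* c)) refl

scale : (k : ℚ) → .{{Positive k}} → RatRightTriangle → RatRightTriangle
scale k t = mkTri (k * a t) (k * b t) (k * c t)
  (k*-pos (a-pos t)) (k*-pos (b-pos t)) (k*-pos (c-pos t)) (pythagoras-scale k (pythag t))
  where
  k*-pos : ∀ {x} → 0ℚ < x → 0ℚ < k * x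
  k*-pos {x} 0<x = positive⁻¹ (k * x) {{pos*pos⇒pos k x {{positive 0<x}}}}

module _ (k : ℚ) .{{_ : Positive k}} (t : RatRightTriangle) where

  area-scale : area (scale k t) ≡ (k * k) * area t
  area-scale = identity k (a t) (b t)
    where
    identity : ∀ k x y → ½ * ((k * x) * (k * y)) ≡ (k * k) * (½ * (x * y))
    identity = solve 3 (λ k x y → con ½ :* ((k :* x) :* (k :* y)) := (k :* k) :* (con ½ :* (x :* y))) refl

  semiperimeter-scale : semiperimeter (scale k t) ≡ k * semiperimeter t
  semiperimeter-scale = identity k (a t) (b t) (c t)
    where
    identity : ∀ k x y z → ½ * (k * x + k * y + k * z) ≡ k * (½ * (x + y + z))
    identity = solve 4 (λ k x y z → con ½ :* (k :* x :+ k :* y :+ k :* z) := k :* (con ½ :* (x :+ y :+ z))) refl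

  exradiusIs-scale : ∀ {x r} → ExradiusIs t x r → ExradiusIs (scale k t) (k * x) (k * r)
  exradiusIs-scale {x} {r} r[s-x]≡area = begin
    (k * r) * (semiperimeter (scale k t) - k * x) ≡⟨ cong (λ s′ → (k * r) * (s′ - k * x)) semiperimeter-scale ⟩
    (k * r) * (k * s - k * x)                     ≡⟨ factor k r s x ⟩
    (k * k) * (r * (s - x))                       ≡⟨ cong ((k * k) *_) r[s-x]≡area ⟩
    (k * k) * area t                              ≡⟨ sym area-scale ⟩
    area (scale k t)                              ∎
    where
    s : ℚ
    s = semiperimeter t
    factor : ∀ k r s x → (k * r) * (k * s - k * x) ≡ (k * k) * (r * (s - x))
    factor = solve 4 (λ k r s x → (k :* r) :* (k :* s :- k :* x) := (k :* k) :* (r :* (s :- x))) refl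

theorem5p3 : (n : ℕ) → Congruent n →
    Σ ℚ λ q → (q ≢ 0ℚ) × Σ RatRightTriangle λ t →
      (area t ≡ (q * q) * ((+ n) / 1)) ×
      (a-exradiusIs t 1ℚ ⊎ b-exradiusIs t 1ℚ ⊎ c-exradiusIs t 1ℚ)
theorem5p3 n (t , area≡n) = q , q≢0 , scale q t , area-scaled , inj₂ (inj₂ c-exradius-scaled)
  where
  s : ℚ
  s = semiperimeter t
  instance
    s-pos : Positive s
    s-pos = semiperimeter-pos t
    s≢0 : NonZero s
    s≢0 = pos⇒nonZero s
  q : ℚ
  q = 1/ s
  instance
    q-pos : Positive q
    q-pos = 1/pos⇒pos s
  q≢0 : q ≢ 0ℚ
  q≢0 = ≢-sym (<⇒≢ (positive⁻¹ q))
  area-scaled : area (scale q t) ≡ (q * q) * ((+ n) / 1)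
  area-scaled = trans (area-scale q t) (cong ((q * q) *_) area≡n)
  c-exradius-scaled : c-exradiusIs (scale q t) 1ℚ
  c-exradius-scaled = subst (ExradiusIs (scale q t) (q * c t)) (*-inverseˡ s)
    (exradiusIs-scale q t (c-exradiusIs-semiperimeter t))
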